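{- For every element $e$ and every $k$ rounds $t_1<t_2<\dots<t_k$ whose pairs contain $e$, conditioned on any realization of the sampled elements $e^{t_1},\dots,e^{t_k}$, the probability that Algorithm 2 never selects $e$ in rounds $t_1,\dots,t_k$ is at most $2^{ -\min\{k,\lceil\frac{k+2}{2}\rceil\}}$.
   Context: Online selection problem: elements $\mathcal{E}$; in each round $t$ a pair $\mathcal{E}^t$ of two distinct elements arrives and the algorithm immediately selects one of them; the instance is fixed in advance. Algorithm 2: each element $e$ has a flag $\tau_e\in\{0,1\}$, initialized independently and uniformly at random. In round $t$, draw $e^t\in\mathcal{E}^t$ uniformly at random (independently of everything else). If $\tau_{e^t}=1$, select $e^t$ and set $\tau_{e^t}=0$; otherwise select the other element of $\mathcal{E}^t$ and set $\tau_{e^t}=1$. -}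

module Defs where

open import Data.Nat using (ℕ; zero; suc; _+_)
open import Data.Bool using (Bool; true; false; if_then_else_; not; _∧_; _∨_)
open import Data.Fin using (Fin; _≟_)
open import Data.Product using (_×_; _,_; proj₁; proj₂)
open import Data.Vec using (Vec; []; _∷_; lookup)
open import Data.List using (List; []; _∷_; map; concatMap; allFin)
open import Relation.Nullary.Decidable using (⌊_⌋)

Pair : ℕ → Set
Pair n = Fin n × Fin n

-- The element e^t drawn uniformly from the pair: coin true ↦ first, false ↦ second.
sampled : ∀ {n} → Pair n → Bool → Fin n
sampled (a , b) c = if c then a else b

other : ∀ {n} → Pair n → Bool → Fin n
other (a , b) c = if c then b else a

_==ᶠ_ : ∀ {n} → Fin n → Fin n → Bool
x ==ᶠ y = ⌊ x ≟ y ⌋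

update : ∀ {n} → (Fin n → Bool) → Fin n → Bool → (Fin n → Bool)
update τ x b y = if y ==ᶠ x then b else τ y

step : ∀ {n} → (Fin n → Bool) → Pair n → Bool → Fin n × (Fin n → Bool)
step τ p c with τ (sampled p c)
... | true  = sampled p c , update τ (sampled p c) false
... | false = other p c , update τ (sampled p c) true

run : ∀ {n T} → (Fin n → Bool) → Vec (Pair n) T → Vec Bool T → Vec (Fin n) T
run τ [] [] = []
run τ (p ∷ ps) (c ∷ cs) with step τ p c
... | s , τ' = s ∷ run τ' ps cs

allBoolVecs : (m : ℕ) → List (Vec Bool m)
allBoolVecs zero = [] ∷ []
allBoolVecs (suc m) = concatMap (λ v → (true ∷ v) ∷ (false ∷ v) ∷ []) (allBoolVecs m)

allB : ∀ {A : Set} → (A → Bool) → List A → Bool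
allB p [] = true
allB p (x ∷ xs) = p x ∧ allB p xs

count : ∀ {A : Set} → (A → Bool) → List A → ℕ
count p [] = zero
count p (x ∷ xs) = if p x then suc (count p xs) else count p xs

-- Sample space of Algorithm 2: initial flags (one uniform bit per element)
-- and one uniform coin per round; all outcomes equally likely.
Outcome : ℕ → ℕ → Set
Outcome n T = Vec Bool n × Vec Bool T

outcomes : (n T : ℕ) → List (Outcome n T)
outcomes n T = concatMap (λ τ → map (λ c → τ , c) (allBoolVecs T)) (allBoolVecs n)

conditionHolds : ∀ {n T} → Vec (Pair n) T → Vec Bool T → (Fin T → Fin n)
               → Outcome n T → Bool
conditionHolds {T = T} pairs S r (τ , c) =
  allB (λ t → not (lookup S t) ∨ (sampled (lookup pairs t) (lookup c t) ==ᶠ r t)) (allFin T)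

neverSelected : ∀ {n T} → Vec (Pair n) T → Vec Bool T → Fin n → Outcome n T → Bool
neverSelected {T = T} pairs S e (τ , c) =
  allB (λ t → not (lookup S t) ∨ not (lookup (run (lookup τ) pairs c) t ==ᶠ e)) (allFin T)

-- Write E for the event that the conditioning holds and e is never selected in the rounds of S.
-- On E, the conditioned rounds fix their coins (the sampled element of round t is r t), and at each
-- such round t the flag of r t equals [r t ≠ e], since e must not be selected. Hence the initial
-- flag of every element realised by some r t is determined by the coins. Moreover, if r i was
-- already realised at an earlier round p of S, its flag flips at p and has to flip back before i;
-- no round of S in between realises r i, so some free round touches r i, and the coin of the last
-- such round s is forced: flipping it would flip the parity of r i at i. So E is determined by the
-- remaining bits, and |E| ≤ 2^(n+T) / 2^(#realised + k + #pinned), while the conditioning event has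
-- at least 2^(n+T) / 2^k outcomes. Each round of S is either the first to realise its element or
-- pins a free round, and a free round is pinned at most once per element of its pair, hence at most
-- once if only one element is realised. This gives #realised + #pinned ≥ min(k, ⌈(k+2)/2⌉).

module Submission where

open import Algebra.Bundles using (CommutativeRing)
open import Data.Bool using (Bool; true; false; not; _∧_; _∨_; _xor_) renaming (_≟_ to _≟ᵇ_)
open import Data.Bool.Properties using (xor-∧-commutativeRing; xor-same; xor-identityʳ; xor-comm; not-¬)
open import Data.Empty using (⊥; ⊥-elim)
open import Data.Fin using (Fin; zero; suc; toℕ; fromℕ<)
open import Data.Fin.Induction using (<-wellFounded)
open import Data.Fin.Properties using (any?; toℕ-fromℕ<; toℕ<n)
import Data.Fin.Properties as Finₚ
open import Data.Fin.Subset using (Subset; _∈_; ∣_∣; inside; outside)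
open import Data.List using (List; []; _∷_; _++_; map; concatMap; allFin) renaming (tabulate to tabulateˡ)
open import Data.List.Properties using (map-++; map-cong; map-∘)
open import Data.Nat using (ℕ; zero; suc; _+_; _*_; _^_; _≤_; _<_; z≤n; s≤s; _⊓_; ⌈_/2⌉)
open import Data.Nat.ListAction using (sum)
open import Data.Nat.ListAction.Properties using (sum-++)
open import Data.Nat.Properties
open import Data.Nat.Solver using (module +-*-Solver)
open import Data.Product using (Σ; _×_; _,_; proj₁; proj₂)
open import Data.Sum using (_⊎_; inj₁; inj₂)
open import Data.Unit using (⊤)
open import Data.Vec using (Vec; []; _∷_; lookup; tabulate; take; drop) renaming (_++_ to _++ᵛ_)
open import Data.Vec.Properties using (take++drop≡id; tabulate∘lookup; tabulate-cong; lookup∘tabulate; lookup⇒[]=)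
open import Function using (_∘_)
open import Induction.WellFounded using (module All)
open import Level using (0ℓ)
open import Relation.Binary.Definitions using (tri<; tri≈; tri>)
open import Relation.Binary.PropositionalEquality
open import Relation.Nullary using (Dec; yes; no)
open import Relation.Nullary.Decidable using (⌊_⌋; _×-dec_)
open import Algebra.Properties.Semiring.Sum +-*-semiring
  using (sum-syntax; sum-cong-≗; ∑-distrib-+; ∑-comm; *-distribˡ-sum) renaming (sum to ∑)
open import Algebra.Properties.CommutativeSemigroup +-commutativeSemigroup
  using () renaming (interchange to +-interchange)
open import Algebra.Properties.CommutativeSemigroup *-commutativeSemigroup
  using () renaming (x∙yz≈y∙xz to m*[n*o]≡n*[m*o])
open import Algebra.Properties.CommutativeSemigroup (CommutativeRing.+-commutativeSemigroup xor-∧-commutativeRing)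
  using () renaming (interchange to xor-interchange)

open import Defs

∧-elim : ∀ {a b} → a ∧ b ≡ true → a ≡ true × b ≡ true
∧-elim {true} {true} _ = refl , refl

∧-intro : ∀ {a b} → a ≡ true → b ≡ true → a ∧ b ≡ true
∧-intro refl refl = refl

∧-true-false : ∀ {a b} → a ≡ true → a ∧ b ≡ false → b ≡ false
∧-true-false refl h = h

not-true : ∀ {a} → not a ≡ true → a ≡ false
not-true {false} _ = refl

not-false : ∀ {a} → a ≡ false → not a ≡ true
not-false refl = refl

∨-false-elim : ∀ {a b} → a ∨ b ≡ false → a ≡ false × b ≡ false
∨-false-elim {false} {false} _ = refl , refl

∨-false-intro : ∀ {a b} → a ≡ false → b ≡ false → a ∨ b ≡ false
∨-false-intro refl refl = refl

xor≡false⇒≡ : ∀ a b → a xor b ≡ false → a ≡ b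
xor≡false⇒≡ true true _ = refl
xor≡false⇒≡ false false _ = refl

⌊⌋-sound : ∀ {P : Set} (d : Dec P) → ⌊ d ⌋ ≡ true → P
⌊⌋-sound (yes p) _ = p

⌊⌋-complete : ∀ {P : Set} (d : Dec P) → P → ⌊ d ⌋ ≡ true
⌊⌋-complete (yes _) _ = refl
⌊⌋-complete (no ¬p) p = ⊥-elim (¬p p)

⟦_⟧ : Bool → ℕ
⟦ true ⟧ = 1
⟦ false ⟧ = 0

⟦⟧≤1 : ∀ b → ⟦ b ⟧ ≤ 1
⟦⟧≤1 true = ≤-refl
⟦⟧≤1 false = z≤n

-- Counting on the Boolean cube

count-∷ : ∀ {A : Set} (p : A → Bool) x xs → count p (x ∷ xs) ≡ ⟦ p x ⟧ + count p xs
count-∷ p x xs with p x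
... | true = refl
... | false = refl

count-bound-inhabited : ∀ {A : Set} (p : A → Bool) xs {b c} →
  (∀ {x} → p x ≡ true → count p xs * b ≤ c) → count p xs * b ≤ c
count-bound-inhabited p [] _ = z≤n
count-bound-inhabited p (x ∷ xs) bound with p x in px
... | true = bound px
... | false = count-bound-inhabited p xs bound

count≡sum : ∀ {A : Set} (p : A → Bool) xs → count p xs ≡ sum (map (⟦_⟧ ∘ p) xs)
count≡sum p [] = refl
count≡sum p (x ∷ xs) = trans (count-∷ p x xs) (cong (⟦ p x ⟧ +_) (count≡sum p xs))

sum-map-+ : ∀ {A : Set} (f g : A → ℕ) xs →
  sum (map (λ x → f x + g x) xs) ≡ sum (map f xs) + sum (map g xs)
sum-map-+ f g [] = refl
sum-map-+ f g (x ∷ xs) = trans (cong (f x + g x +_) (sum-map-+ f g xs)) (+-interchange (f x) (g x) _ _)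

sum-map-concatMap : ∀ {A B : Set} (f : B → ℕ) (g : A → List B) xs →
  sum (map f (concatMap g xs)) ≡ sum (map (λ x → sum (map f (g x))) xs)
sum-map-concatMap f g [] = refl
sum-map-concatMap f g (x ∷ xs) = begin
  sum (map f (g x ++ concatMap g xs))               ≡⟨ cong sum (map-++ f (g x) _) ⟩
  sum (map f (g x) ++ map f (concatMap g xs))       ≡⟨ sum-++ (map f (g x)) _ ⟩
  sum (map f (g x)) + sum (map f (concatMap g xs))  ≡⟨ cong (sum (map f (g x)) +_) (sum-map-concatMap f g xs) ⟩
  sum (map f (g x)) + sum (map (λ y → sum (map f (g y))) xs) ∎
  where open ≡-Reasoning

allB-tabulate : ∀ {A : Set} {N} (p : A → Bool) (f : Fin N → A) → (∀ i → p (f i) ≡ true) → allB p (tabulateˡ f) ≡ true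
allB-tabulate {N = zero} p f all = refl
allB-tabulate {N = suc N} p f all = ∧-intro (all zero) (allB-tabulate p (f ∘ suc) (all ∘ suc))

allB-tabulate⁻ : ∀ {A : Set} {N} (p : A → Bool) (f : Fin N → A) → allB p (tabulateˡ f) ≡ true → ∀ i → p (f i) ≡ true
allB-tabulate⁻ {N = suc N} p f h zero = proj₁ (∧-elim h)
allB-tabulate⁻ {N = suc N} p f h (suc i) = allB-tabulate⁻ p (f ∘ suc) (proj₂ (∧-elim {p (f zero)} h)) i

∑ᶜ : (N : ℕ) → (Vec Bool N → ℕ) → ℕ
∑ᶜ zero f = f []
∑ᶜ (suc N) f = ∑ᶜ N (f ∘ (true ∷_)) + ∑ᶜ N (f ∘ (false ∷_))

sum-map-allBoolVecs : ∀ N (f : Vec Bool N → ℕ) → sum (map f (allBoolVecs N)) ≡ ∑ᶜ N f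
sum-map-allBoolVecs zero f = +-identityʳ (f [])
sum-map-allBoolVecs (suc N) f = begin
  sum (map f (concatMap (λ v → (true ∷ v) ∷ (false ∷ v) ∷ []) (allBoolVecs N)))
    ≡⟨ sum-map-concatMap f _ (allBoolVecs N) ⟩
  sum (map (λ v → f (true ∷ v) + (f (false ∷ v) + 0)) (allBoolVecs N))
    ≡⟨ cong sum (map-cong (λ v → cong (f (true ∷ v) +_) (+-identityʳ _)) (allBoolVecs N)) ⟩
  sum (map (λ v → f (true ∷ v) + f (false ∷ v)) (allBoolVecs N))
    ≡⟨ sum-map-+ (f ∘ (true ∷_)) (f ∘ (false ∷_)) (allBoolVecs N) ⟩
  sum (map (f ∘ (true ∷_)) (allBoolVecs N)) + sum (map (f ∘ (false ∷_)) (allBoolVecs N))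
    ≡⟨ cong₂ _+_ (sum-map-allBoolVecs N _) (sum-map-allBoolVecs N _) ⟩
  ∑ᶜ (suc N) f ∎
  where open ≡-Reasoning

count-outcomes : ∀ n T (p : Outcome n T → Bool) →
  count p (outcomes n T) ≡ ∑ᶜ n (λ τ → ∑ᶜ T (λ c → ⟦ p (τ , c) ⟧))
count-outcomes n T p = begin
  count p (outcomes n T)
    ≡⟨ count≡sum p (outcomes n T) ⟩
  sum (map (⟦_⟧ ∘ p) (outcomes n T))
    ≡⟨ sum-map-concatMap (⟦_⟧ ∘ p) _ (allBoolVecs n) ⟩
  sum (map (λ τ → sum (map (⟦_⟧ ∘ p) (map (τ ,_) (allBoolVecs T)))) (allBoolVecs n))
    ≡⟨ cong sum (map-cong slice (allBoolVecs n)) ⟩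
  sum (map (λ τ → ∑ᶜ T (λ c → ⟦ p (τ , c) ⟧)) (allBoolVecs n))
    ≡⟨ sum-map-allBoolVecs n _ ⟩
  ∑ᶜ n (λ τ → ∑ᶜ T (λ c → ⟦ p (τ , c) ⟧)) ∎
  where
  open ≡-Reasoning
  slice : ∀ τ → sum (map (⟦_⟧ ∘ p) (map (τ ,_) (allBoolVecs T))) ≡ ∑ᶜ T (λ c → ⟦ p (τ , c) ⟧)
  slice τ = trans (cong sum (sym (map-∘ (allBoolVecs T)))) (sum-map-allBoolVecs T _)

∑ᶜ-const : ∀ N W → ∑ᶜ N (λ _ → W) ≡ 2 ^ N * W
∑ᶜ-const zero W = sym (+-identityʳ W)
∑ᶜ-const (suc N) W = begin
  ∑ᶜ N (λ _ → W) + ∑ᶜ N (λ _ → W)   ≡⟨ cong₂ _+_ (∑ᶜ-const N W) (∑ᶜ-const N W) ⟩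
  2 ^ N * W + 2 ^ N * W             ≡⟨ sym (*-distribʳ-+ W (2 ^ N) (2 ^ N)) ⟩
  (2 ^ N + 2 ^ N) * W               ≡⟨ cong (λ z → (2 ^ N + z) * W) (sym (+-identityʳ (2 ^ N))) ⟩
  2 ^ suc N * W ∎
  where open ≡-Reasoning

∑ᶜ-split : ∀ n T (g : Vec Bool n → Vec Bool T → ℕ) →
  ∑ᶜ n (λ τ → ∑ᶜ T (g τ)) ≡ ∑ᶜ (n + T) (λ w → g (take n w) (drop n w))
∑ᶜ-split zero T g = refl
∑ᶜ-split (suc n) T g = cong₂ _+_ (∑ᶜ-split n T (g ∘ (true ∷_))) (∑ᶜ-split n T (g ∘ (false ∷_)))

∑ᶜ-+ : ∀ N (f g : Vec Bool N → ℕ) → ∑ᶜ N (λ v → f v + g v) ≡ ∑ᶜ N f + ∑ᶜ N g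
∑ᶜ-+ zero f g = refl
∑ᶜ-+ (suc N) f g =
  trans (cong₂ _+_ (∑ᶜ-+ N (f ∘ (true ∷_)) (g ∘ (true ∷_))) (∑ᶜ-+ N (f ∘ (false ∷_)) (g ∘ (false ∷_))))
        (+-interchange (∑ᶜ N (f ∘ (true ∷_))) _ _ _)

∑ᶜ-mono : ∀ N {f g : Vec Bool N → ℕ} → (∀ v → f v ≤ g v) → ∑ᶜ N f ≤ ∑ᶜ N g
∑ᶜ-mono zero f≤g = f≤g []
∑ᶜ-mono (suc N) f≤g = +-mono-≤ (∑ᶜ-mono N (f≤g ∘ (true ∷_))) (∑ᶜ-mono N (f≤g ∘ (false ∷_)))

lookup-ext : ∀ {A : Set} {N} {u v : Vec A N} → (∀ j → lookup u j ≡ lookup v j) → u ≡ v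
lookup-ext {u = u} {v} pointwise = trans (sym (tabulate∘lookup u)) (trans (tabulate-cong pointwise) (tabulate∘lookup v))

AgreeOff : ∀ {N} → Subset N → Vec Bool N → Vec Bool N → Set
AgreeOff [] [] [] = ⊤
AgreeOff (p ∷ P) (a ∷ u) (b ∷ v) = (p ≡ outside → a ≡ b) × AgreeOff P u v

AgreeOff-refl : ∀ {N} (P : Subset N) u → AgreeOff P u u
AgreeOff-refl [] [] = _
AgreeOff-refl (p ∷ P) (a ∷ u) = (λ _ → refl) , AgreeOff-refl P u

AgreeOff-lookup : ∀ {N} (P : Subset N) u v → AgreeOff P u v →
  ∀ j → lookup P j ≡ outside → lookup u j ≡ lookup v j
AgreeOff-lookup (p ∷ P) (a ∷ u) (b ∷ v) (head , _) zero = head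
AgreeOff-lookup (p ∷ P) (a ∷ u) (b ∷ v) (_ , tail) (suc j) = AgreeOff-lookup P u v tail j

AgreeOff-++ : ∀ {n T} (P : Subset n) (Q : Subset T) u v → AgreeOff (P ++ᵛ Q) u v →
  AgreeOff P (take n u) (take n v) × AgreeOff Q (drop n u) (drop n v)
AgreeOff-++ [] Q u v ag = _ , ag
AgreeOff-++ (p ∷ P) Q (a ∷ u) (b ∷ v) (head , ag) =
  let agP , agQ = AgreeOff-++ P Q u v ag in (head , agP) , agQ

DeterminedOff : ∀ {N} → Subset N → (Vec Bool N → Bool) → Set
DeterminedOff P E = ∀ u v → E u ≡ true → E v ≡ true → AgreeOff P u v → u ≡ v

∣P++Q∣ : ∀ {n T} (P : Subset n) (Q : Subset T) → ∣ P ++ᵛ Q ∣ ≡ ∣ P ∣ + ∣ Q ∣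
∣P++Q∣ [] Q = refl
∣P++Q∣ (inside ∷ P) Q = cong suc (∣P++Q∣ P Q)
∣P++Q∣ (outside ∷ P) Q = ∣P++Q∣ P Q

∑ᶜ-determinedOff : ∀ N (E : Vec Bool N → Bool) (P : Subset N) → DeterminedOff P E →
  ∑ᶜ N (⟦_⟧ ∘ E) * 2 ^ ∣ P ∣ ≤ 2 ^ N
∑ᶜ-determinedOff zero E [] det = subst (_≤ 1) (sym (*-identityʳ ⟦ E [] ⟧)) (⟦⟧≤1 (E []))
∑ᶜ-determinedOff (suc N) E (outside ∷ P) det = begin
  (∑ᶜ N (⟦_⟧ ∘ E₁) + ∑ᶜ N (⟦_⟧ ∘ E₀)) * 2 ^ ∣ P ∣
    ≡⟨ *-distribʳ-+ (2 ^ ∣ P ∣) (∑ᶜ N (⟦_⟧ ∘ E₁)) _ ⟩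
  ∑ᶜ N (⟦_⟧ ∘ E₁) * 2 ^ ∣ P ∣ + ∑ᶜ N (⟦_⟧ ∘ E₀) * 2 ^ ∣ P ∣
    ≤⟨ +-mono-≤ (∑ᶜ-determinedOff N E₁ P (slice true)) (∑ᶜ-determinedOff N E₀ P (slice false)) ⟩
  2 ^ N + 2 ^ N
    ≡⟨ cong (2 ^ N +_) (sym (+-identityʳ (2 ^ N))) ⟩
  2 ^ suc N ∎
  where
  open ≤-Reasoning
  E₁ E₀ : Vec Bool N → Bool
  E₁ = E ∘ (true ∷_)
  E₀ = E ∘ (false ∷_)
  slice : ∀ b → DeterminedOff P (E ∘ (b ∷_))
  slice b u v Eu Ev ag = cong Data.Vec.tail (det (b ∷ u) (b ∷ v) Eu Ev ((λ _ → refl) , ag))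
∑ᶜ-determinedOff (suc N) E (inside ∷ P) det = begin
  (∑ᶜ N (⟦_⟧ ∘ E₁) + ∑ᶜ N (⟦_⟧ ∘ E₀)) * (2 * 2 ^ ∣ P ∣)
    ≡⟨ cong (_* (2 * 2 ^ ∣ P ∣)) (sym (∑ᶜ-+ N (⟦_⟧ ∘ E₁) (⟦_⟧ ∘ E₀))) ⟩
  ∑ᶜ N (λ v → ⟦ E₁ v ⟧ + ⟦ E₀ v ⟧) * (2 * 2 ^ ∣ P ∣)
    ≤⟨ *-monoˡ-≤ (2 * 2 ^ ∣ P ∣) (∑ᶜ-mono N (λ v → disjoint (E₁ v) (E₀ v) (exclusive v))) ⟩
  ∑ᶜ N (⟦_⟧ ∘ E′) * (2 * 2 ^ ∣ P ∣)
    ≡⟨ m*[n*o]≡n*[m*o] (∑ᶜ N (⟦_⟧ ∘ E′)) 2 (2 ^ ∣ P ∣) ⟩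
  2 * (∑ᶜ N (⟦_⟧ ∘ E′) * 2 ^ ∣ P ∣)
    ≤⟨ *-monoʳ-≤ 2 (∑ᶜ-determinedOff N E′ P merged) ⟩
  2 ^ suc N ∎
  where
  open ≤-Reasoning
  E₁ E₀ E′ : Vec Bool N → Bool
  E₁ = E ∘ (true ∷_)
  E₀ = E ∘ (false ∷_)
  E′ v = E₁ v ∨ E₀ v
  exclusive : ∀ v → E₁ v ≡ true → E₀ v ≡ true → ⊥
  exclusive v E₁v E₀v with det (true ∷ v) (false ∷ v) E₁v E₀v ((λ ()) , AgreeOff-refl P v)
  ... | ()
  disjoint : ∀ a b → (a ≡ true → b ≡ true → ⊥) → ⟦ a ⟧ + ⟦ b ⟧ ≤ ⟦ a ∨ b ⟧
  disjoint true true excl = ⊥-elim (excl refl refl)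
  disjoint true false excl = ≤-refl
  disjoint false b excl = ≤-refl
  witness : ∀ v → E′ v ≡ true → Σ Bool λ b → E (b ∷ v) ≡ true
  witness v E′v with E₁ v in E₁v
  ... | true = true , E₁v
  ... | false = false , E′v
  merged : DeterminedOff P E′
  merged u v E′u E′v ag =
    let a , Eu = witness u E′u
        b , Ev = witness v E′v
    in cong Data.Vec.tail (det (a ∷ u) (b ∷ v) Eu Ev ((λ ()) , ag))

count-determinedOff : ∀ n T (E : Outcome n T → Bool) (Pn : Subset n) (PT : Subset T) →
  (∀ τ c τ′ c′ → E (τ , c) ≡ true → E (τ′ , c′) ≡ true →
     AgreeOff Pn τ τ′ → AgreeOff PT c c′ → (τ , c) ≡ (τ′ , c′)) →
  count E (outcomes n T) * 2 ^ (∣ Pn ∣ + ∣ PT ∣) ≤ 2 ^ (n + T)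
count-determinedOff n T E Pn PT det = begin
  count E (outcomes n T) * 2 ^ (∣ Pn ∣ + ∣ PT ∣)
    ≡⟨ cong₂ _*_ (trans (count-outcomes n T E) (∑ᶜ-split n T _)) (cong (2 ^_) (sym (∣P++Q∣ Pn PT))) ⟩
  ∑ᶜ (n + T) (⟦_⟧ ∘ E′) * 2 ^ ∣ Pn ++ᵛ PT ∣
    ≤⟨ ∑ᶜ-determinedOff (n + T) E′ (Pn ++ᵛ PT) det′ ⟩
  2 ^ (n + T) ∎
  where
  open ≤-Reasoning
  E′ : Vec Bool (n + T) → Bool
  E′ w = E (take n w , drop n w)
  det′ : DeterminedOff (Pn ++ᵛ PT) E′
  det′ u v Eu Ev ag =
    let agn , agT = AgreeOff-++ Pn PT u v ag
    in trans (sym (take++drop≡id n u))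
         (trans (cong (λ ω → proj₁ ω ++ᵛ proj₂ ω) (det _ _ _ _ Eu Ev agn agT)) (take++drop≡id n v))

∑ᶜ-box-lowerBound : ∀ N (Q : Vec Bool N → Bool) (S : Subset N) (allowed : Fin N → Bool → Bool) →
  (∀ c → (∀ t → allowed t (lookup c t) ≡ true) → Q c ≡ true) →
  (∀ t → Σ Bool λ b → allowed t b ≡ true) →
  (∀ t → lookup S t ≡ outside → ∀ b → allowed t b ≡ true) →
  2 ^ N ≤ ∑ᶜ N (⟦_⟧ ∘ Q) * 2 ^ ∣ S ∣
∑ᶜ-box-lowerBound zero Q [] allowed box nonempty full rewrite box [] (λ ()) = ≤-refl
∑ᶜ-box-lowerBound (suc N) Q (s ∷ S) allowed box nonempty full = bound s refl
  where
  open ≤-Reasoning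
  A : Bool → ℕ
  A b = ∑ᶜ N (⟦_⟧ ∘ Q ∘ (b ∷_))
  slice : ∀ b → allowed zero b ≡ true → 2 ^ N ≤ A b * 2 ^ ∣ S ∣
  slice b allowed-b = ∑ᶜ-box-lowerBound N (Q ∘ (b ∷_)) S (allowed ∘ suc)
    (λ c h → box (b ∷ c) λ { zero → allowed-b ; (suc t) → h t })
    (nonempty ∘ suc) (full ∘ suc)
  A≤sum : ∀ b → A b ≤ A true + A false
  A≤sum true = m≤m+n (A true) (A false)
  A≤sum false = m≤n+m (A false) (A true)
  bound : ∀ s′ → s′ ≡ s → 2 ^ suc N ≤ (A true + A false) * 2 ^ ∣ s ∷ S ∣
  bound outside refl = begin
    2 ^ N + (2 ^ N + 0)                        ≡⟨ cong (2 ^ N +_) (+-identityʳ (2 ^ N)) ⟩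
    2 ^ N + 2 ^ N                              ≤⟨ +-mono-≤ (slice true (full zero refl true)) (slice false (full zero refl false)) ⟩
    A true * 2 ^ ∣ S ∣ + A false * 2 ^ ∣ S ∣   ≡⟨ sym (*-distribʳ-+ (2 ^ ∣ S ∣) (A true) (A false)) ⟩
    (A true + A false) * 2 ^ ∣ S ∣ ∎
  bound inside refl = let b , allowed-b = nonempty zero in begin
    2 * 2 ^ N                                  ≤⟨ *-monoʳ-≤ 2 (slice b allowed-b) ⟩
    2 * (A b * 2 ^ ∣ S ∣)                      ≤⟨ *-monoʳ-≤ 2 (*-monoˡ-≤ (2 ^ ∣ S ∣) (A≤sum b)) ⟩
    2 * ((A true + A false) * 2 ^ ∣ S ∣)       ≡⟨ m*[n*o]≡n*[m*o] 2 (A true + A false) (2 ^ ∣ S ∣) ⟩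
    (A true + A false) * (2 * 2 ^ ∣ S ∣) ∎

-- Counting subsets of Fin N

#_ : ∀ {N} → (Fin N → Bool) → ℕ
#_ {N} f = ∑[ i < N ] ⟦ f i ⟧

∑-mono : ∀ {N} {f g : Fin N → ℕ} → (∀ i → f i ≤ g i) → ∑ f ≤ ∑ g
∑-mono {zero} f≤g = z≤n
∑-mono {suc N} f≤g = +-mono-≤ (f≤g zero) (∑-mono (f≤g ∘ suc))

#-none : ∀ {N} (f : Fin N → Bool) → (∀ i → f i ≡ false) → # f ≡ 0
#-none {zero} f none = refl
#-none {suc N} f none rewrite none zero = #-none (f ∘ suc) (none ∘ suc)

#-pos : ∀ {N} (f : Fin N → Bool) j → f j ≡ true → 1 ≤ # f
#-pos f zero fj rewrite fj = s≤s z≤n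
#-pos f (suc j) fj = ≤-trans (#-pos (f ∘ suc) j fj) (m≤n+m _ ⟦ f zero ⟧)

#-two : ∀ {N} (f : Fin N → Bool) x y → f x ≡ true → f y ≡ true → x ≢ y → 2 ≤ # f
#-two f zero zero fx fy x≢y = ⊥-elim (x≢y refl)
#-two f zero (suc y) fx fy x≢y rewrite fx = s≤s (#-pos (f ∘ suc) y fy)
#-two f (suc x) zero fx fy x≢y rewrite fy = s≤s (#-pos (f ∘ suc) x fx)
#-two f (suc x) (suc y) fx fy x≢y =
  ≤-trans (#-two (f ∘ suc) x y fx fy (x≢y ∘ cong suc)) (m≤n+m _ ⟦ f zero ⟧)

#-unique : ∀ {N} (f : Fin N → Bool) → (∀ i j → f i ≡ true → f j ≡ true → i ≡ j) → # f ≤ 1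
#-unique {zero} f unique = z≤n
#-unique {suc N} f unique with f zero in f0
... | true = ≤-reflexive (cong suc (#-none (f ∘ suc) rest))
  where
  rest : ∀ i → f (suc i) ≡ false
  rest i with f (suc i) in fi
  ... | false = refl
  ... | true with unique zero (suc i) f0 fi
  ... | ()
... | false = #-unique (f ∘ suc) λ i j fi fj → Finₚ.suc-injective (unique (suc i) (suc j) fi fj)

#-no-increasing-pair : ∀ {N} (f : Fin N → Bool) →
  (∀ i j → f i ≡ true → f j ≡ true → toℕ i < toℕ j → ⊥) → # f ≤ 1
#-no-increasing-pair f no-pair = #-unique f unique
  where
  unique : ∀ i j → f i ≡ true → f j ≡ true → i ≡ j
  unique i j fi fj with Finₚ.<-cmp i j
  ... | tri< i<j _ _ = ⊥-elim (no-pair i j fi fj i<j)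
  ... | tri≈ _ i≡j _ = i≡j
  ... | tri> _ _ j<i = ⊥-elim (no-pair j i fj fi j<i)

#-partition : ∀ {N} (f g : Fin N → Bool) → # f ≡ # (λ i → f i ∧ g i) + # (λ i → f i ∧ not (g i))
#-partition f g = trans (sum-cong-≗ λ i → split (f i) (g i))
                        (∑-distrib-+ (λ i → ⟦ f i ∧ g i ⟧) (λ i → ⟦ f i ∧ not (g i) ⟧))
  where
  split : ∀ a b → ⟦ a ⟧ ≡ ⟦ a ∧ b ⟧ + ⟦ a ∧ not b ⟧
  split true true = refl
  split true false = refl
  split false b = refl

#-∨ : ∀ {N} (f g : Fin N → Bool) → (∀ i → f i ≡ true → g i ≡ true → ⊥) → # (λ i → f i ∨ g i) ≡ # f + # g
#-∨ f g disjoint = trans (sum-cong-≗ λ i → ⟦∨⟧ (f i) (g i) (disjoint i)) (∑-distrib-+ (⟦_⟧ ∘ f) (⟦_⟧ ∘ g))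
  where
  ⟦∨⟧ : ∀ a b → (a ≡ true → b ≡ true → ⊥) → ⟦ a ∨ b ⟧ ≡ ⟦ a ⟧ + ⟦ b ⟧
  ⟦∨⟧ true true excl = ⊥-elim (excl refl refl)
  ⟦∨⟧ true false excl = refl
  ⟦∨⟧ false b excl = refl

#-cover₂ : ∀ {N} (f g h : Fin N → Bool) → (∀ i → f i ≡ true → g i ∨ h i ≡ true) → # f ≤ # g + # h
#-cover₂ f g h cover = ≤-trans (∑-mono λ i → bound (f i) (g i) (h i) (cover i))
                               (≤-reflexive (∑-distrib-+ (⟦_⟧ ∘ g) (⟦_⟧ ∘ h)))
  where
  bound : ∀ a b c → (a ≡ true → b ∨ c ≡ true) → ⟦ a ⟧ ≤ ⟦ b ⟧ + ⟦ c ⟧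
  bound false b c _ = z≤n
  bound true true c _ = s≤s z≤n
  bound true false true _ = s≤s z≤n
  bound true false false a⇒ with a⇒ refl
  ... | ()

#-fibres : ∀ {A M} (Q : Fin A → Bool) (B : Fin M → Bool) (R : Fin A → Fin M → Bool) c →
  (∀ i → Q i ≡ true → Σ (Fin M) λ j → R i j ≡ true) →
  (∀ i j → R i j ≡ true → B j ≡ true) →
  (∀ j → # (λ i → R i j) ≤ c) →
  # Q ≤ c * # B
#-fibres {A} {M} Q B R c partner R⇒B fibre = begin
  # Q                              ≤⟨ ∑-mono hasPartner ⟩
  ∑[ i < A ] # (R i)               ≡⟨ ∑-comm (λ i j → ⟦ R i j ⟧) ⟩
  ∑[ j < M ] # (λ i → R i j)       ≤⟨ ∑-mono fibre≤ ⟩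
  ∑[ j < M ] (c * ⟦ B j ⟧)          ≡⟨ sym (*-distribˡ-sum c (⟦_⟧ ∘ B)) ⟩
  c * # B ∎
  where
  open ≤-Reasoning
  hasPartner : ∀ i → ⟦ Q i ⟧ ≤ # (R i)
  hasPartner i with Q i in Qi
  ... | false = z≤n
  ... | true = let j , Rij = partner i Qi in #-pos (R i) j Rij
  fibre≤ : ∀ j → # (λ i → R i j) ≤ c * ⟦ B j ⟧
  fibre≤ j with B j in Bj
  ... | true = ≤-trans (fibre j) (≤-reflexive (sym (*-identityʳ c)))
  ... | false = ≤-trans (≤-reflexive (#-none (λ i → R i j) notR)) z≤n
    where
    notR : ∀ i → R i j ≡ false
    notR i with R i j in Rij
    ... | false = refl
    ... | true with trans (sym (R⇒B i j Rij)) Bj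
    ... | ()

∣tabulate∣ : ∀ {N} (f : Fin N → Bool) → ∣ tabulate f ∣ ≡ # f
∣tabulate∣ {zero} f = refl
∣tabulate∣ {suc N} f with f zero
... | true = cong suc (∣tabulate∣ (f ∘ suc))
... | false = ∣tabulate∣ (f ∘ suc)

∣S∣≡#lookup : ∀ {N} (S : Subset N) → ∣ S ∣ ≡ # (lookup S)
∣S∣≡#lookup S = trans (cong ∣_∣ (sym (tabulate∘lookup S))) (∣tabulate∣ (lookup S))

anyᶠ : ∀ {N} → (Fin N → Bool) → Bool
anyᶠ f = ⌊ any? (λ i → f i ≟ᵇ true) ⌋

anyᶠ-intro : ∀ {N} (f : Fin N → Bool) j → f j ≡ true → anyᶠ f ≡ true
anyᶠ-intro f j fj = ⌊⌋-complete (any? (λ i → f i ≟ᵇ true)) (j , fj)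

anyᶠ-elim : ∀ {N} (f : Fin N → Bool) → anyᶠ f ≡ true → Σ (Fin N) λ j → f j ≡ true
anyᶠ-elim f = ⌊⌋-sound (any? (λ i → f i ≟ᵇ true))

anyᶠ-false : ∀ {N} (f : Fin N → Bool) → anyᶠ f ≡ false → ∀ j → f j ≡ false
anyᶠ-false f h j with f j in fj
... | false = refl
... | true with trans (sym (anyᶠ-intro f j fj)) h
... | ()

anyᶠ-none : ∀ {N} (f : Fin N → Bool) → (∀ j → f j ≡ false) → anyᶠ f ≡ false
anyᶠ-none f none with anyᶠ f in h
... | false = refl
... | true with anyᶠ-elim f h
... | j , fj with trans (sym fj) (none j)
... | ()

lastBelow : ∀ {N} (Φ : Fin N → Bool) b u → toℕ u < b → Φ u ≡ true →
  Σ (Fin N) λ m → toℕ m < b × Φ m ≡ true × (∀ v → toℕ m < toℕ v → toℕ v < b → Φ v ≡ false)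
lastBelow Φ (suc b) u u<b Φu with any? (λ v → (toℕ v ≟ b) ×-dec (Φ v ≟ᵇ true))
... | yes (m , m≡b , Φm) = m , s≤s (≤-reflexive m≡b) , Φm ,
      λ v m<v v<b → ⊥-elim (<⇒≱ (subst (_< toℕ v) m≡b m<v) (≤-pred v<b))
... | no none with m≤n⇒m<n∨m≡n (≤-pred u<b)
...   | inj₂ u≡b = ⊥-elim (none (u , u≡b , Φu))
...   | inj₁ u<b′ =
  let m , m<b , Φm , last = lastBelow Φ b u u<b′ Φu in
  m , m<n⇒m<1+n m<b , Φm , extend m last
  where
  extend : ∀ m → (∀ v → toℕ m < toℕ v → toℕ v < b → Φ v ≡ false) →
           ∀ v → toℕ m < toℕ v → toℕ v < suc b → Φ v ≡ false
  extend m last v m<v v<sb with m≤n⇒m<n∨m≡n (≤-pred v<sb) | Φ v in Φv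
  ... | _ | false = refl
  ... | inj₁ v<b | true = trans (sym Φv) (last v m<v v<b)
  ... | inj₂ v≡b | true = ⊥-elim (none (v , v≡b , Φv))

⌈/2⌉-bound : ∀ {m a} → m ≤ a + a → ⌈ m /2⌉ ≤ a
⌈/2⌉-bound {a = a} m≤2a = ≤-trans (⌈n/2⌉-mono m≤2a) (≤-reflexive (sym (n≡⌈n+n/2⌉ a)))

-- Runs of Algorithm 2

==ᶠ⇒≡ : ∀ {n} {x y : Fin n} → x ==ᶠ y ≡ true → x ≡ y
==ᶠ⇒≡ {x = x} {y} = ⌊⌋-sound (x Finₚ.≟ y)

==ᶠ-refl : ∀ {n} (x : Fin n) → x ==ᶠ x ≡ true
==ᶠ-refl x = ⌊⌋-complete (x Finₚ.≟ x) refl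

≢⇒==ᶠ-false : ∀ {n} {x y : Fin n} → x ≢ y → x ==ᶠ y ≡ false
≢⇒==ᶠ-false {x = x} {y} x≢y with x Finₚ.≟ y
... | yes x≡y = ⊥-elim (x≢y x≡y)
... | no _ = refl

==ᶠ-false⇒≢ : ∀ {n} {x y : Fin n} → x ==ᶠ y ≡ false → x ≢ y
==ᶠ-false⇒≢ {x = x} h refl with trans (sym (==ᶠ-refl x)) h
... | ()

touches : ∀ {n} → Fin n → Pair n → Bool
touches x p = (x ==ᶠ proj₁ p) ∨ (x ==ᶠ proj₂ p)

untouched⇒unsampled : ∀ {n} x (p : Pair n) c → touches x p ≡ false → x ==ᶠ sampled p c ≡ false
untouched⇒unsampled x (a , b) c h with x ==ᶠ a in xa
untouched⇒unsampled x (a , b) true () | true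
untouched⇒unsampled x (a , b) false () | true
... | false with c
... | true = xa
... | false = h

touched-once : ∀ {n} x {a b : Fin n} → a ≢ b → touches x (a , b) ≡ true → (x ==ᶠ a) xor (x ==ᶠ b) ≡ true
touched-once x {a} {b} a≢b h with x ==ᶠ a in xa | x ==ᶠ b in xb
... | true | true = ⊥-elim (a≢b (trans (sym (==ᶠ⇒≡ xa)) (==ᶠ⇒≡ xb)))
... | true | false = refl
... | false | true = refl

touched⇒coin-sensitive : ∀ {n} x (p : Pair n) c c′ → proj₁ p ≢ proj₂ p → touches x p ≡ true → c ≢ c′ →
  (x ==ᶠ sampled p c) xor (x ==ᶠ sampled p c′) ≡ true
touched⇒coin-sensitive x (a , b) true true a≢b h c≢c′ = ⊥-elim (c≢c′ refl)
touched⇒coin-sensitive x (a , b) false false a≢b h c≢c′ = ⊥-elim (c≢c′ refl)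
touched⇒coin-sensitive x (a , b) true false a≢b h _ = touched-once x a≢b h
touched⇒coin-sensitive x (a , b) false true a≢b h _ = trans (xor-comm (x ==ᶠ b) (x ==ᶠ a)) (touched-once x a≢b h)

sampled-injective : ∀ {n} (p : Pair n) {c c′} → proj₁ p ≢ proj₂ p → sampled p c ≡ sampled p c′ → c ≡ c′
sampled-injective p {true} {true} a≢b h = refl
sampled-injective p {true} {false} a≢b h = ⊥-elim (a≢b h)
sampled-injective p {false} {true} a≢b h = ⊥-elim (a≢b (sym h))
sampled-injective p {false} {false} a≢b h = refl

flagsAfter : ∀ {n T} → (Fin n → Bool) → Vec (Pair n) T → Vec Bool T → ℕ → Fin n → Bool
flagsAfter τ ps cs zero = τ
flagsAfter τ [] [] (suc m) = τ
flagsAfter τ (p ∷ ps) (c ∷ cs) (suc m) = flagsAfter (proj₂ (step τ p c)) ps cs m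

run-lookup : ∀ {n T} (τ : Fin n → Bool) (ps : Vec (Pair n) T) cs (t : Fin T) →
  lookup (run τ ps cs) t ≡ proj₁ (step (flagsAfter τ ps cs (toℕ t)) (lookup ps t) (lookup cs t))
run-lookup τ (p ∷ ps) (c ∷ cs) zero with step τ p c
... | _ , _ = refl
run-lookup τ (p ∷ ps) (c ∷ cs) (suc t) with step τ p c
... | _ , τ′ = run-lookup τ′ ps cs t

update-flags : ∀ {n} (τ : Fin n → Bool) s y b → b ≡ not (τ s) → update τ s b y ≡ τ y xor (y ==ᶠ s)
update-flags τ s y b b≡ with y ==ᶠ s in ys
... | false = sym (xor-identityʳ (τ y))
... | true = trans b≡ (trans (cong (not ∘ τ) (sym (==ᶠ⇒≡ ys))) (sym (xor-comm (τ y) true)))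

step-flags : ∀ {n} (τ : Fin n → Bool) p c y → proj₂ (step τ p c) y ≡ τ y xor (y ==ᶠ sampled p c)
step-flags τ p c y with τ (sampled p c) in τs
... | true = update-flags τ _ y false (cong not (sym τs))
... | false = update-flags τ _ y true (cong not (sym τs))

flagsAfter-suc : ∀ {n T} (τ : Fin n → Bool) (ps : Vec (Pair n) T) cs (t : Fin T) y →
  flagsAfter τ ps cs (suc (toℕ t)) y
    ≡ flagsAfter τ ps cs (toℕ t) y xor (y ==ᶠ sampled (lookup ps t) (lookup cs t))
flagsAfter-suc τ (p ∷ ps) (c ∷ cs) zero y = step-flags τ p c y
flagsAfter-suc τ (p ∷ ps) (c ∷ cs) (suc t) y = flagsAfter-suc (proj₂ (step τ p c)) ps cs t y

unselected⇒flag : ∀ {n} (τ : Fin n → Bool) (p : Pair n) c e → (e ≡ proj₁ p ⊎ e ≡ proj₂ p) →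
  proj₁ (step τ p c) ==ᶠ e ≡ false → τ (sampled p c) ≡ not (sampled p c ==ᶠ e)
unselected⇒flag τ p c e e∈p unselected with τ (sampled p c)
... | true rewrite unselected = refl
... | false with sampled p c ==ᶠ e in se
... | true = refl
... | false = ⊥-elim (==ᶠ-false⇒≢ unselected (sym (other≡e p c e∈p (==ᶠ-false⇒≢ se ∘ sym))))
  where
  other≡e : ∀ {n} (p : Pair n) c {e} → (e ≡ proj₁ p ⊎ e ≡ proj₂ p) → e ≢ sampled p c → e ≡ other p c
  other≡e (a , b) true (inj₁ e≡a) e≢s = ⊥-elim (e≢s e≡a)
  other≡e (a , b) true (inj₂ e≡b) e≢s = e≡b
  other≡e (a , b) false (inj₁ e≡a) e≢s = e≡a
  other≡e (a , b) false (inj₂ e≡b) e≢s = ⊥-elim (e≢s e≡b)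

module XorDriven {T : ℕ} (G : ℕ → Bool) (D : Fin T → Bool)
  (G-step : ∀ u → G (suc (toℕ u)) ≡ G (toℕ u) xor D u) where

  constant : ∀ {a b} → a ≤ b → b ≤ T → (∀ u → a ≤ toℕ u → toℕ u < b → D u ≡ false) → G b ≡ G a
  constant {b = zero} z≤n _ _ = refl
  constant {a} {suc b} a≤sb sb≤T quiet with m≤n⇒m<n∨m≡n a≤sb
  ... | inj₂ refl = refl
  ... | inj₁ a<sb = begin
    G (suc b)             ≡⟨ cong (G ∘ suc) (sym u≡b) ⟩
    G (suc (toℕ u))       ≡⟨ G-step u ⟩
    G (toℕ u) xor D u     ≡⟨ cong₂ _xor_ (cong G u≡b) (quiet u (subst (a ≤_) (sym u≡b) (≤-pred a<sb)) (s≤s (≤-reflexive u≡b))) ⟩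
    G b xor false         ≡⟨ xor-identityʳ (G b) ⟩
    G b                   ≡⟨ constant (≤-pred a<sb) (<⇒≤ sb≤T) (λ v a≤v v<b → quiet v a≤v (m<n⇒m<1+n v<b)) ⟩
    G a ∎
    where
    open ≡-Reasoning
    u : Fin T
    u = fromℕ< sb≤T
    u≡b : toℕ u ≡ b
    u≡b = toℕ-fromℕ< sb≤T

  flips : ∀ u → D u ≡ true → G (suc (toℕ u)) ≡ not (G (toℕ u))
  flips u Du = trans (G-step u) (trans (cong (G (toℕ u) xor_) Du) (xor-comm (G (toℕ u)) true))

-- Outcomes in which e is never selected

module NeverSelected (n T : ℕ) (pairs : Vec (Pair n) T)
  (distinct : ∀ t → proj₁ (lookup pairs t) ≢ proj₂ (lookup pairs t))
  (e : Fin n) (S : Subset T)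
  (e∈pair : ∀ t → t ∈ S → e ≡ proj₁ (lookup pairs t) ⊎ e ≡ proj₂ (lookup pairs t))
  (r : Fin T → Fin n) where

  inS : Fin T → Bool
  inS = lookup S

  pair : Fin T → Pair n
  pair = lookup pairs

  Event : Outcome n T → Bool
  Event ω = conditionHolds pairs S r ω ∧ neverSelected pairs S e ω

  sampledAt : Outcome n T → Fin T → Fin n
  sampledAt (τ , c) t = sampled (pair t) (lookup c t)

  flag : Outcome n T → ℕ → Fin n → Bool
  flag (τ , c) = flagsAfter (lookup τ) pairs c

  flag-suc : ∀ ω u x → flag ω (suc (toℕ u)) x ≡ flag ω (toℕ u) x xor (x ==ᶠ sampledAt ω u)
  flag-suc (τ , c) = flagsAfter-suc (lookup τ) pairs c

  Event⇒sampled≡r : ∀ {ω} → Event ω ≡ true → ∀ t → inS t ≡ true → sampledAt ω t ≡ r t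
  Event⇒sampled≡r ev t t∈S with allB-tabulate⁻ _ _ (proj₁ (∧-elim ev)) t
  ... | h rewrite t∈S = ==ᶠ⇒≡ h

  Event⇒unselected : ∀ {τ c} → Event (τ , c) ≡ true → ∀ t → inS t ≡ true →
    lookup (run (lookup τ) pairs c) t ==ᶠ e ≡ false
  Event⇒unselected {τ} {c} ev t t∈S with allB-tabulate⁻ _ _ (proj₂ (∧-elim {conditionHolds pairs S r (τ , c)} ev)) t
  ... | h rewrite t∈S = not-true h

  flag-invariant : ∀ {ω} → Event ω ≡ true → ∀ t → inS t ≡ true → flag ω (toℕ t) (r t) ≡ not (r t ==ᶠ e)
  flag-invariant {τ , c} ev t t∈S =
    subst (λ x → flag (τ , c) (toℕ t) x ≡ not (x ==ᶠ e)) (Event⇒sampled≡r {τ , c} ev t t∈S)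
      (unselected⇒flag (flag (τ , c) (toℕ t)) (pair t) (lookup c t) e (e∈pair t (lookup⇒[]= t S t∈S))
        (trans (cong (_==ᶠ e) (sym (run-lookup (lookup τ) pairs c t))) (Event⇒unselected {τ} {c} ev t t∈S)))

  _≺_ : Fin T → Fin T → Bool
  s ≺ t = ⌊ s Finₚ.<? t ⌋

  ≺-sound : ∀ {s t} → s ≺ t ≡ true → toℕ s < toℕ t
  ≺-sound {s} {t} = ⌊⌋-sound (s Finₚ.<? t)

  ≺-complete : ∀ {s t} → toℕ s < toℕ t → s ≺ t ≡ true
  ≺-complete {s} {t} = ⌊⌋-complete (s Finₚ.<? t)

  realises : Fin n → Fin T → Bool
  realises x p = inS p ∧ (r p ==ᶠ x)

  freeTouch : Fin n → Fin T → Bool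
  freeTouch x u = not (inS u) ∧ touches x (pair u)

  blocks : Fin n → Fin T → Bool
  blocks x u = freeTouch x u ∨ realises x u

  realisedBefore : Fin n → Fin T → Bool
  realisedBefore x s = anyᶠ (λ p → realises x p ∧ p ≺ s)

  unblockedBetween : Fin n → Fin T → Fin T → Bool
  unblockedBetween x s i = not (anyᶠ (λ u → s ≺ u ∧ u ≺ i ∧ blocks x u))

  repeated : Fin T → Bool
  repeated i = realisedBefore (r i) i

  -- On E, the coin of a pinned round s is determined by the coins before it.
  pins : Fin T → Fin T → Bool
  pins i s = inS i ∧ freeTouch (r i) s ∧ s ≺ i ∧ unblockedBetween (r i) s i ∧ realisedBefore (r i) s

  record Pins (i s : Fin T) : Set where
    field
      i∈S : inS i ≡ true
      s-freeTouch : freeTouch (r i) s ≡ true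
      s<i : toℕ s < toℕ i
      unblocked : ∀ u → toℕ s < toℕ u → toℕ u < toℕ i → blocks (r i) u ≡ false
      p : Fin T
      p-realises : realises (r i) p ≡ true
      p<s : toℕ p < toℕ s

  pins-elim : ∀ {i s} → pins i s ≡ true → Pins i s
  pins-elim {i} {s} h with ∧-elim {inS i} h
  ... | i∈S , h₁ with ∧-elim {freeTouch (r i) s} h₁
  ... | ft , h₂ with ∧-elim {s ≺ i} h₂
  ... | s≺i , h₃ with ∧-elim {unblockedBetween (r i) s i} h₃
  ... | ub , rb with anyᶠ-elim _ rb
  ... | p , h₄ with ∧-elim {realises (r i) p} h₄
  ... | p-realises , p≺s = record
    { i∈S = i∈S ; s-freeTouch = ft ; s<i = ≺-sound s≺i
    ; unblocked = λ u s<u u<i → ∧-true-false (≺-complete u<i)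
                    (∧-true-false (≺-complete s<u) (anyᶠ-false _ (not-true ub) u))
    ; p = p ; p-realises = p-realises ; p<s = ≺-sound p≺s }

  pins-intro : ∀ {i s} → Pins i s → pins i s ≡ true
  pins-intro {i} {s} P = ∧-intro i∈S (∧-intro s-freeTouch (∧-intro (≺-complete s<i)
      (∧-intro (not-false (anyᶠ-none _ blocked-between)) (anyᶠ-intro _ p (∧-intro p-realises (≺-complete p<s))))))
    where
    open Pins P
    blocked-between : ∀ u → s ≺ u ∧ u ≺ i ∧ blocks (r i) u ≡ false
    blocked-between u with s ≺ u in s≺u | u ≺ i in u≺i
    ... | false | _ = refl
    ... | true | false = refl
    ... | true | true = unblocked u (≺-sound s≺u) (≺-sound u≺i)

  realised : Fin n → Bool
  realised x = anyᶠ (realises x)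

  pinned : Fin T → Bool
  pinned s = anyᶠ (λ i → pins i s)

  determinedCoin : Fin T → Bool
  determinedCoin t = inS t ∨ pinned t

  module Revisit {ω} (ev : Event ω ≡ true) (i : Fin T) (i∈S : inS i ≡ true)
    (p : Fin T) (p<i : toℕ p < toℕ i) (p-realises : realises (r i) p ≡ true)
    (p-last : ∀ v → toℕ p < toℕ v → toℕ v < toℕ i → realises (r i) v ≡ false) where

    x : Fin n
    x = r i

    candidate : Fin T → Bool
    candidate s = p ≺ s ∧ freeTouch x s

    lastCandidate-pins : ∀ s₀ → toℕ s₀ < toℕ i → candidate s₀ ≡ true → Σ (Fin T) λ s → pins i s ≡ true
    lastCandidate-pins s₀ s₀<i c₀ =
      let s , s<i , cs , s-last = lastBelow candidate (toℕ i) s₀ s₀<i c₀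
          p≺s , ft = ∧-elim {p ≺ s} cs
          unblocked : ∀ u → toℕ s < toℕ u → toℕ u < toℕ i → blocks x u ≡ false
          unblocked u s<u u<i =
            let p<u = <-trans (≺-sound p≺s) s<u
            in ∨-false-intro (∧-true-false (≺-complete p<u) (s-last u s<u u<i)) (p-last u p<u u<i)
      in s , pins-intro record { i∈S = i∈S ; s-freeTouch = ft ; s<i = s<i ; unblocked = unblocked
                               ; p = p ; p-realises = p-realises ; p<s = ≺-sound p≺s }

    p∈S : inS p ≡ true
    p∈S = proj₁ (∧-elim {inS p} p-realises)

    rp≡x : r p ≡ x
    rp≡x = ==ᶠ⇒≡ (proj₂ (∧-elim {inS p} p-realises))

    some-candidate : Σ (Fin T) λ s → toℕ s < toℕ i × candidate s ≡ true
    some-candidate with any? (λ s → (s Finₚ.<? i) ×-dec (candidate s ≟ᵇ true))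
    ... | yes found = found
    ... | no none = ⊥-elim (not-¬ flag-i≡flag-p flag-i≡not-flag-p)
      where
      open XorDriven (λ m → flag ω m x) (λ u → x ==ᶠ sampledAt ω u) (λ u → flag-suc ω u x)
      noCandidate : ∀ u → toℕ u < toℕ i → candidate u ≡ false
      noCandidate u u<i with candidate u in cu
      ... | false = refl
      ... | true = ⊥-elim (none (u , u<i , cu))
      sampled-p : x ==ᶠ sampledAt ω p ≡ true
      sampled-p = subst (λ y → x ==ᶠ y ≡ true) (sym (trans (Event⇒sampled≡r {ω} ev p p∈S) rp≡x)) (==ᶠ-refl x)
      quiet : ∀ u → suc (toℕ p) ≤ toℕ u → toℕ u < toℕ i → x ==ᶠ sampledAt ω u ≡ false
      quiet u p<u u<i with inS u in u∈S
      ... | true = subst (λ y → x ==ᶠ y ≡ false) (sym (Event⇒sampled≡r {ω} ev u u∈S))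
                     (≢⇒==ᶠ-false λ x≡ru → ==ᶠ-false⇒≢ (∧-true-false u∈S (p-last u p<u u<i)) (sym x≡ru))
      ... | false = untouched⇒unsampled x (pair u) _
                      (∧-true-false (not-false u∈S) (∧-true-false (≺-complete p<u) (noCandidate u u<i)))
      flag-i≡flag-p : flag ω (toℕ i) x ≡ flag ω (toℕ p) x
      flag-i≡flag-p = trans (flag-invariant {ω} ev i i∈S)
        (sym (subst (λ y → flag ω (toℕ p) y ≡ not (y ==ᶠ e)) rp≡x (flag-invariant {ω} ev p p∈S)))
      flag-i≡not-flag-p : flag ω (toℕ i) x ≡ not (flag ω (toℕ p) x)
      flag-i≡not-flag-p = trans (constant p<i (<⇒≤ (toℕ<n i)) quiet) (flips p sampled-p)

  revisit⇒pinned : ∀ {ω} → Event ω ≡ true → ∀ i → inS i ≡ true → repeated i ≡ true →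
                   Σ (Fin T) λ s → pins i s ≡ true
  revisit⇒pinned {ω} ev i i∈S rep =
    let p₀ , h = anyᶠ-elim _ rep
        p₀-realises , p₀≺i = ∧-elim {realises (r i) p₀} h
        p , p<i , p-realises , p-last = lastBelow (realises (r i)) (toℕ i) p₀ (≺-sound p₀≺i) p₀-realises
        open Revisit {ω} ev i i∈S p p<i p-realises p-last
        s₀ , s₀<i , c₀ = some-candidate
    in lastCandidate-pins s₀ s₀<i c₀

  module Difference {τ τ′ : Vec Bool n} {c c′ : Vec Bool T}
    (ev : Event (τ , c) ≡ true) (ev′ : Event (τ′ , c′) ≡ true) where

    ω ω′ : Outcome n T
    ω = τ , c
    ω′ = τ′ , c′

    δ : Fin n → ℕ → Bool
    δ x m = flag ω m x xor flag ω′ m x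

    Δ : Fin n → Fin T → Bool
    Δ x u = (x ==ᶠ sampledAt ω u) xor (x ==ᶠ sampledAt ω′ u)

    δ-suc : ∀ x u → δ x (suc (toℕ u)) ≡ δ x (toℕ u) xor Δ x u
    δ-suc x u = trans (cong₂ _xor_ (flag-suc ω u x) (flag-suc ω′ u x))
      (xor-interchange (flag ω (toℕ u) x) (x ==ᶠ sampledAt ω u) (flag ω′ (toℕ u) x) (x ==ᶠ sampledAt ω′ u))

    δ-realised : ∀ x p → realises x p ≡ true → δ x (toℕ p) ≡ false
    δ-realised x p h =
      let p∈S , rp==x = ∧-elim {inS p} h
      in subst (λ y → δ y (toℕ p) ≡ false) (==ᶠ⇒≡ rp==x)
           (trans (cong₂ _xor_ (flag-invariant {ω} ev p p∈S) (flag-invariant {ω′} ev′ p p∈S))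
                  (xor-same (not (r p ==ᶠ e))))

    Δ-conditioned : ∀ x u → inS u ≡ true → Δ x u ≡ false
    Δ-conditioned x u u∈S =
      trans (cong₂ (λ a b → (x ==ᶠ a) xor (x ==ᶠ b))
                   (Event⇒sampled≡r {ω} ev u u∈S) (Event⇒sampled≡r {ω′} ev′ u u∈S))
            (xor-same (x ==ᶠ r u))

    Δ-sameCoin : ∀ x u → lookup c u ≡ lookup c′ u → Δ x u ≡ false
    Δ-sameCoin x u c≡c′ = trans (cong (λ b → (x ==ᶠ sampledAt ω u) xor (x ==ᶠ sampled (pair u) b)) (sym c≡c′))
                              (xor-same (x ==ᶠ sampledAt ω u))

    Δ-untouched : ∀ x u → touches x (pair u) ≡ false → Δ x u ≡ false
    Δ-untouched x u h = cong₂ _xor_ (untouched⇒unsampled x (pair u) _ h) (untouched⇒unsampled x (pair u) _ h)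

    pinned-coin-agrees : ∀ {i t} → Pins i t → (∀ {u} → toℕ u < toℕ t → lookup c u ≡ lookup c′ u) →
                         lookup c t ≡ lookup c′ t
    pinned-coin-agrees {i} {t} P earlier with lookup c t ≟ᵇ lookup c′ t
    ... | yes c≡c′ = c≡c′
    ... | no c≢c′ = ⊥-elim (not-¬ (δ-realised x i (∧-intro i∈S (==ᶠ-refl x))) δ-i)
      where
      open Pins P
      x : Fin n
      x = r i
      open XorDriven (δ x) (Δ x) (δ-suc x)
      δ-t : δ x (toℕ t) ≡ false
      δ-t = trans (constant (<⇒≤ p<s) (<⇒≤ (toℕ<n t)) (λ u _ u<t → Δ-sameCoin x u (earlier u<t)))
                  (δ-realised x p p-realises)
      Δ-t : Δ x t ≡ true
      Δ-t = touched⇒coin-sensitive x (pair t) _ _ (distinct t) (proj₂ (∧-elim {not (inS t)} s-freeTouch)) c≢c′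
      quiet : ∀ u → suc (toℕ t) ≤ toℕ u → toℕ u < toℕ i → Δ x u ≡ false
      quiet u t<u u<i with inS u in u∈S
      ... | true = Δ-conditioned x u u∈S
      ... | false = Δ-untouched x u (∧-true-false (not-false u∈S) (proj₁ (∨-false-elim (unblocked u t<u u<i))))
      δ-i : δ x (toℕ i) ≡ true
      δ-i = trans (constant s<i (<⇒≤ (toℕ<n i)) quiet) (trans (flips t Δ-t) (cong not δ-t))

    coins-agree : AgreeOff (tabulate determinedCoin) c c′ → ∀ t → lookup c t ≡ lookup c′ t
    coins-agree ag = All.wfRec <-wellFounded 0ℓ (λ t → lookup c t ≡ lookup c′ t) coin-agrees
      where
      coin-agrees : ∀ t → (∀ {u} → toℕ u < toℕ t → lookup c u ≡ lookup c′ u) → lookup c t ≡ lookup c′ t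
      coin-agrees t earlier with inS t in t∈S
      ... | true = sampled-injective (pair t) (distinct t)
                     (trans (Event⇒sampled≡r {ω} ev t t∈S) (sym (Event⇒sampled≡r {ω′} ev′ t t∈S)))
      ... | false with pinned t in t-pinned
      ...   | false = AgreeOff-lookup _ c c′ ag t (trans (lookup∘tabulate determinedCoin t) (∨-false-intro t∈S t-pinned))
      ...   | true = let i , h = anyᶠ-elim _ t-pinned in pinned-coin-agrees (pins-elim h) earlier

    flags-agree : (∀ u → lookup c u ≡ lookup c′ u) → AgreeOff (tabulate realised) τ τ′ →
                  ∀ x → lookup τ x ≡ lookup τ′ x
    flags-agree coins ag x with realised x in x-realised
    ... | false = AgreeOff-lookup _ τ τ′ ag x (trans (lookup∘tabulate realised x) x-realised)
    ... | true = let i , h = anyᶠ-elim _ x-realised in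
      xor≡false⇒≡ _ _ (trans (sym (XorDriven.constant (δ x) (Δ x) (δ-suc x) z≤n (<⇒≤ (toℕ<n i))
                                      (λ u _ _ → Δ-sameCoin x u (coins u))))
                            (δ-realised x i h))

  Event-determined : ∀ τ c τ′ c′ → Event (τ , c) ≡ true → Event (τ′ , c′) ≡ true →
    AgreeOff (tabulate realised) τ τ′ → AgreeOff (tabulate determinedCoin) c c′ → (τ , c) ≡ (τ′ , c′)
  Event-determined τ c τ′ c′ ev ev′ agτ agc = cong₂ _,_ (lookup-ext (flags-agree coins agτ)) (lookup-ext coins)
    where
    open Difference {τ} {τ′} {c} {c′} ev ev′
    coins : ∀ t → lookup c t ≡ lookup c′ t
    coins = coins-agree agc

  realises-self : ∀ {i y} → inS i ≡ true → r i ≡ y → realises y i ≡ true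
  realises-self {i} i∈S refl = ∧-intro i∈S (==ᶠ-refl (r i))

  pins-increasing⇒distinct : ∀ {i j s} → pins i s ≡ true → pins j s ≡ true → toℕ i < toℕ j → r i ≢ r j
  pins-increasing⇒distinct {i} {j} hi hj i<j ri≡rj =
    not-¬ (realises-self (Pins.i∈S (pins-elim hi)) ri≡rj)
          (proj₂ (∨-false-elim (Pins.unblocked (pins-elim hj) i (Pins.s<i (pins-elim hi)) i<j)))

  #pins-at : ∀ s y → # (λ i → pins i s ∧ (r i ==ᶠ y)) ≤ 1
  #pins-at s y = #-no-increasing-pair _ λ i j hi hj i<j →
    let pi , ri≡y = ∧-elim {pins i s} hi
        pj , rj≡y = ∧-elim {pins j s} hj
    in pins-increasing⇒distinct pi pj i<j (trans (==ᶠ⇒≡ ri≡y) (sym (==ᶠ⇒≡ rj≡y)))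

  #pins≤2 : ∀ s → # (λ i → pins i s) ≤ 2
  #pins≤2 s = ≤-trans (#-cover₂ _ (λ i → pins i s ∧ (r i ==ᶠ a)) (λ i → pins i s ∧ (r i ==ᶠ b)) covered)
                      (+-mono-≤ (#pins-at s a) (#pins-at s b))
    where
    a b : Fin n
    a = proj₁ (pair s)
    b = proj₂ (pair s)
    covered : ∀ i → pins i s ≡ true → (pins i s ∧ (r i ==ᶠ a)) ∨ (pins i s ∧ (r i ==ᶠ b)) ≡ true
    covered i h rewrite h = proj₂ (∧-elim {not (inS s)} (Pins.s-freeTouch (pins-elim h)))

  #pins≤1 : # realised ≤ 1 → ∀ s → # (λ i → pins i s) ≤ 1
  #pins≤1 #realised≤1 s = #-no-increasing-pair _ λ i j hi hj i<j →
    pins-increasing⇒distinct hi hj i<j (same-realised (Pins.i∈S (pins-elim hi)) (Pins.i∈S (pins-elim hj)))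
    where
    same-realised : ∀ {i j} → inS i ≡ true → inS j ≡ true → r i ≡ r j
    same-realised {i} {j} i∈S j∈S with r i Finₚ.≟ r j
    ... | yes ri≡rj = ri≡rj
    ... | no ri≢rj = ⊥-elim (<⇒≱ (#-two realised (r i) (r j) (realised-self i∈S) (realised-self j∈S) ri≢rj) #realised≤1)
      where
      realised-self : ∀ {k} → inS k ≡ true → realised (r k) ≡ true
      realised-self {k} k∈S = anyᶠ-intro _ k (realises-self k∈S refl)

  firstVisit revisit : Fin T → Bool
  firstVisit i = inS i ∧ not (repeated i)
  revisit i = inS i ∧ repeated i

  #firstVisit≤#realised : # firstVisit ≤ # realised
  #firstVisit≤#realised = subst (# firstVisit ≤_) (*-identityˡ (# realised))
    (#-fibres firstVisit realised (λ i x → firstVisit i ∧ (r i ==ᶠ x)) 1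
      (λ i h → r i , ∧-intro h (==ᶠ-refl (r i)))
      (λ i x h → let fv , ri≡x = ∧-elim {firstVisit i} h
                 in anyᶠ-intro _ i (realises-self (proj₁ (∧-elim {inS i} fv)) (==ᶠ⇒≡ ri≡x)))
      (λ x → #-no-increasing-pair _ λ i j hi hj i<j →
        let fvi , ri≡x = ∧-elim {firstVisit i} hi
            fvj , rj≡x = ∧-elim {firstVisit j} hj
            i∈S = proj₁ (∧-elim {inS i} fvi)
            ri≡rj = trans (==ᶠ⇒≡ ri≡x) (sym (==ᶠ⇒≡ rj≡x))
        in not-¬ (anyᶠ-intro _ i (∧-intro (realises-self i∈S ri≡rj) (≺-complete i<j)))
                 (not-true (proj₂ (∧-elim {inS j} fvj)))))

  #revisit≤ : ∀ {ω} → Event ω ≡ true → ∀ k → (∀ s → # (λ i → pins i s) ≤ k) → # revisit ≤ k * # pinned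
  #revisit≤ {ω} ev k fibre = #-fibres revisit pinned pins k
    (λ i h → let i∈S , rep = ∧-elim {inS i} h in revisit⇒pinned {ω} ev i i∈S rep)
    (λ i s h → anyᶠ-intro (λ i → pins i s) i h)
    fibre

  #determinedCoin : # determinedCoin ≡ # inS + # pinned
  #determinedCoin = #-∨ inS pinned λ t t∈S t-pinned →
    let i , h = anyᶠ-elim _ t-pinned
    in not-¬ t∈S (not-true (proj₁ (∧-elim {not (inS t)} (Pins.s-freeTouch (pins-elim h)))))

  exponent-bound : ∀ {ω} → Event ω ≡ true → # inS ⊓ ⌈ # inS + 2 /2⌉ ≤ # realised + # pinned
  exponent-bound {ω} ev with 2 ≤? # realised
  ... | yes two = ≤-trans (m⊓n≤n (# inS) _) (⌈/2⌉-bound (begin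
        # inS + 2                                 ≡⟨ cong (_+ 2) (#-partition inS repeated) ⟩
        # revisit + # firstVisit + 2              ≤⟨ +-mono-≤ (+-mono-≤ (#revisit≤ {ω} ev 2 #pins≤2) #firstVisit≤#realised) two ⟩
        2 * # pinned + # realised + # realised    ≡⟨ double (# realised) (# pinned) ⟩
        (# realised + # pinned) + (# realised + # pinned) ∎))
    where
    open ≤-Reasoning
    double : ∀ a b → 2 * b + a + a ≡ (a + b) + (a + b)
    double = +-*-Solver.solve 2 (λ a b → con 2 :* b :+ a :+ a := (a :+ b) :+ (a :+ b)) refl
      where open +-*-Solver
  ... | no ¬two = ≤-trans (m⊓n≤m (# inS) _) (begin
        # inS                         ≡⟨ #-partition inS repeated ⟩
        # revisit + # firstVisit      ≤⟨ +-mono-≤ (#revisit≤ {ω} ev 1 (#pins≤1 (≤-pred (≰⇒> ¬two)))) #firstVisit≤#realised ⟩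
        1 * # pinned + # realised     ≡⟨ trans (cong (_+ # realised) (*-identityˡ (# pinned))) (+-comm (# pinned) _) ⟩
        # realised + # pinned ∎)
    where open ≤-Reasoning

  count-Event-bound : count Event (outcomes n T) * 2 ^ (∣ S ∣ ⊓ ⌈ ∣ S ∣ + 2 /2⌉ + ∣ S ∣) ≤ 2 ^ (n + T)
  count-Event-bound = count-bound-inhabited Event (outcomes n T) λ {ω} ev → begin
    count Event (outcomes n T) * 2 ^ (∣ S ∣ ⊓ ⌈ ∣ S ∣ + 2 /2⌉ + ∣ S ∣)
      ≤⟨ *-monoʳ-≤ (count Event (outcomes n T)) (^-monoʳ-≤ 2 (exponent≤ {ω} ev)) ⟩
    count Event (outcomes n T) * 2 ^ (∣ tabulate realised ∣ + ∣ tabulate determinedCoin ∣)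
      ≤⟨ count-determinedOff n T Event (tabulate realised) (tabulate determinedCoin) Event-determined ⟩
    2 ^ (n + T) ∎
    where
    open ≤-Reasoning
    exponent≤ : ∀ {ω} → Event ω ≡ true →
                ∣ S ∣ ⊓ ⌈ ∣ S ∣ + 2 /2⌉ + ∣ S ∣ ≤ ∣ tabulate realised ∣ + ∣ tabulate determinedCoin ∣
    exponent≤ {ω} ev rewrite ∣S∣≡#lookup S | ∣tabulate∣ realised | ∣tabulate∣ determinedCoin | #determinedCoin =
      ≤-trans (+-monoˡ-≤ (# inS) (exponent-bound {ω} ev)) (≤-reflexive (+-assoc-comm (# realised) (# pinned) (# inS)))
      where
      +-assoc-comm : ∀ a b c → a + b + c ≡ a + (c + b)
      +-assoc-comm a b c = trans (+-assoc a b c) (cong (a +_) (+-comm b c))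

-- The conditioning event

count-condition-lowerBound : ∀ n T (pairs : Vec (Pair n) T) (S : Subset T) (r : Fin T → Fin n) →
  (∀ t → t ∈ S → r t ≡ proj₁ (lookup pairs t) ⊎ r t ≡ proj₂ (lookup pairs t)) →
  2 ^ (n + T) ≤ count (conditionHolds pairs S r) (outcomes n T) * 2 ^ ∣ S ∣
count-condition-lowerBound n T pairs S r r∈pair = begin
  2 ^ (n + T)            ≡⟨ ^-distribˡ-+-* 2 n T ⟩
  2 ^ n * 2 ^ T          ≤⟨ *-monoʳ-≤ (2 ^ n) (∑ᶜ-box-lowerBound T Cc S allowed box nonempty full) ⟩
  2 ^ n * (W * 2 ^ ∣ S ∣) ≡⟨ sym (*-assoc (2 ^ n) W (2 ^ ∣ S ∣)) ⟩
  2 ^ n * W * 2 ^ ∣ S ∣   ≡⟨ cong (_* 2 ^ ∣ S ∣) (sym (trans (count-outcomes n T _) (∑ᶜ-const n W))) ⟩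
  count (conditionHolds pairs S r) (outcomes n T) * 2 ^ ∣ S ∣ ∎
  where
  open ≤-Reasoning
  allowed : Fin T → Bool → Bool
  allowed t b = not (lookup S t) ∨ (sampled (lookup pairs t) b ==ᶠ r t)
  Cc : Vec Bool T → Bool
  Cc c = allB (λ t → allowed t (lookup c t)) (allFin T)
  W : ℕ
  W = ∑ᶜ T (⟦_⟧ ∘ Cc)
  box : ∀ c → (∀ t → allowed t (lookup c t) ≡ true) → Cc c ≡ true
  box c = allB-tabulate _ (λ t → t)
  nonempty : ∀ t → Σ Bool λ b → allowed t b ≡ true
  nonempty t with lookup S t in t∈S
  ... | outside = true , refl
  ... | inside with r∈pair t (lookup⇒[]= t S t∈S)
  ...   | inj₁ r≡a = true , subst (λ y → proj₁ (lookup pairs t) ==ᶠ y ≡ true) (sym r≡a) (==ᶠ-refl _)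
  ...   | inj₂ r≡b = false , subst (λ y → proj₂ (lookup pairs t) ==ᶠ y ≡ true) (sym r≡b) (==ᶠ-refl _)
  full : ∀ t → lookup S t ≡ outside → ∀ b → allowed t b ≡ true
  full t t∉S b rewrite t∉S = refl

mainTheorem6 : (n T : ℕ) (pairs : Vec (Pair n) T)
  → (∀ t → proj₁ (lookup pairs t) ≢ proj₂ (lookup pairs t))
  → (e : Fin n) (k : ℕ) (S : Subset T) → ∣ S ∣ ≡ k
  → (∀ t → t ∈ S → (e ≡ proj₁ (lookup pairs t) ⊎ e ≡ proj₂ (lookup pairs t)))
  → (r : Fin T → Fin n)
  → (∀ t → t ∈ S → (r t ≡ proj₁ (lookup pairs t) ⊎ r t ≡ proj₂ (lookup pairs t)))
  → count (λ ω → conditionHolds pairs S r ω ∧ neverSelected pairs S e ω) (outcomes n T)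
      * 2 ^ (k ⊓ ⌈ k + 2 /2⌉)
    ≤ count (conditionHolds pairs S r) (outcomes n T)
mainTheorem6 n T pairs distinct e .(∣ S ∣) S refl e∈pair r r∈pair =
  *-cancelʳ-≤ _ _ (2 ^ ∣ S ∣) {{m^n≢0 2 ∣ S ∣}} (begin
  A * 2 ^ m * 2 ^ ∣ S ∣     ≡⟨ *-assoc A (2 ^ m) (2 ^ ∣ S ∣) ⟩
  A * (2 ^ m * 2 ^ ∣ S ∣)   ≡⟨ cong (A *_) (sym (^-distribˡ-+-* 2 m ∣ S ∣)) ⟩
  A * 2 ^ (m + ∣ S ∣)       ≤⟨ count-Event-bound ⟩
  2 ^ (n + T)               ≤⟨ count-condition-lowerBound n T pairs S r r∈pair ⟩
  count (conditionHolds pairs S r) (outcomes n T) * 2 ^ ∣ S ∣ ∎)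
  where
  open NeverSelected n T pairs distinct e S e∈pair r
  open ≤-Reasoning
  A m : ℕ
  A = count Event (outcomes n T)
  m = ∣ S ∣ ⊓ ⌈ ∣ S ∣ + 2 /2⌉
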